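{- Let $r\ge 2$ be an integer and $F$ a graph. There is a constant $C=C(F,r)$ such that if $\mathcal{H}$ is an $n$-vertex $r$-uniform hypergraph containing no member of $\mathrm{tr}(F)$ as a subhypergraph, then the shadow graph $G$ of $\mathcal{H}$ contains at most $C n^{|V(F)|-1}$ copies of $F$.
   Context: For a graph $F$, $\mathrm{tr}(F)$ denotes the family of $r$-uniform hypergraphs $\mathcal{F}$ for which there is a copy of $F$ on a vertex set $V(F)\subseteq V(\mathcal{F})$ and a bijection $f$ from the edges of $F$ to the hyperedges of $\mathcal{F}$ such that $f(e)\cap V(F)=e$ for every edge $e$ of $F$. The shadow graph of a hypergraph $\mathcal{H}$ has vertex set $V(\mathcal{H})$, with $uv$ an edge iff some hyperedge of $\mathcal{H}$ contains both $u$ and $v$. -}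

module Defs where

open import Data.Nat using (ℕ; _<_)
open import Data.Bool using (Bool; true; false)
open import Data.Fin using (Fin; toℕ)
open import Data.Fin.Subset using (Subset; _∈_; ∣_∣)
open import Data.Product using (Σ; ∃; _×_; _,_)
open import Data.Sum using (_⊎_)
open import Function.Bundles using (_⇔_)
open import Function.Definitions using (Injective)
open import Relation.Binary.PropositionalEquality using (_≡_; _≢_)
open import Relation.Nullary using (¬_)

record Graph (k : ℕ) : Set where
  field
    adj   : Fin k → Fin k → Bool
    sym   : ∀ i j → adj i j ≡ adj j i
    irrefl : ∀ i → adj i i ≡ false
open Graph public

record Hypergraph (r n : ℕ) : Set where
  field
    IsEdge  : Subset n → Bool
    uniform : ∀ e → IsEdge e ≡ true → ∣ e ∣ ≡ r
open Hypergraph public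

Shadow : ∀ {r n} → Hypergraph r n → Fin n → Fin n → Set
Shadow H u v = u ≢ v × ∃ λ e → IsEdge H e ≡ true × u ∈ e × v ∈ e

EdgeOf : ∀ {k} → Graph k → Set
EdgeOf {k} F = Σ (Fin k) λ i → Σ (Fin k) λ j → (toℕ i < toℕ j) × (adj F i j ≡ true)

-- H contains (as a subhypergraph) some member of tr(F): there is an
-- embedding φ of V(F) into V(H) and an injective map f from edges of F to
-- hyperedges of H such that f(ij) ∩ φ(V(F)) = {φ i , φ j}.
ContainsTr : ∀ {k r n} → Graph k → Hypergraph r n → Set
ContainsTr {k} F H =
  Σ (Fin k → Fin _) λ φ → Injective _≡_ _≡_ φ ×
  Σ (EdgeOf F → Subset _) λ f → Injective _≡_ _≡_ f ×
  ((e : EdgeOf F) → IsEdge H (f e) ≡ true) ×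
  ((e : EdgeOf F) → let (i , j , _) = e in
     ∀ l → (φ l ∈ f e) ⇔ (l ≡ i ⊎ l ≡ j))

SubgraphData : ℕ → Set
SubgraphData n = Subset n × (Fin n → Fin n → Bool)

SameSubgraph : ∀ {n} → SubgraphData n → SubgraphData n → Set
SameSubgraph (S₁ , E₁) (S₂ , E₂) = S₁ ≡ S₂ × (∀ u v → E₁ u v ≡ E₂ u v)

Distinct : ∀ {n} → SubgraphData n → SubgraphData n → Set
Distinct c d = ¬ SameSubgraph c d

-- (S , E) is a copy of F in the graph G (given by an adjacency relation):
-- it is a subgraph of G isomorphic to F, i.e. the image of an injective
-- edge-preserving map φ : V(F) → V(G).
IsCopy : ∀ {k n} → Graph k → (Fin n → Fin n → Set) → SubgraphData n → Set
IsCopy {k} F G (S , E) =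
  Σ (Fin k → Fin _) λ φ → Injective _≡_ _≡_ φ ×
  (∀ i j → adj F i j ≡ true → G (φ i) (φ j)) ×
  (∀ u → (u ∈ S) ⇔ (∃ λ i → φ i ≡ u)) ×
  (∀ u v → (E u v ≡ true) ⇔ (∃ λ i → ∃ λ j → adj F i j ≡ true × φ i ≡ u × φ j ≡ v))

{-# OPTIONS --safe #-}
-- Fix, for every shadow edge uv, one hyperedge h(uv) containing u and v.  For a
-- copy φ of F in the shadow, mapping each edge ij to h(φi φj) is a trace of F
-- unless some h(φi φj) contains a third vertex φl of the copy.  So in a
-- tr(F)-free H every copy has such a "stray" vertex l, and the copy is
-- recovered from i, j, l, the restriction of φ to the other k - 1 vertices
-- (which determines h(φi φj)) and the rank of φl inside that r-set.  This
-- encodes the copies injectively into k³ r n^(k-1) values.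
module Submission where

open import Defs hiding (sym)
open import Data.Nat using (ℕ; _≤_; _*_; _^_; _∸_; suc; _<_; s≤s)
open import Data.Nat.Properties using (_<?_; ≮⇒≥; <-asym; <-irrefl; <-irrelevant)
open import Data.Bool using (Bool; true; false)
import Data.Bool as Bool
open import Data.Fin using (Fin; zero; suc; toℕ; combine; cast; _≟_; punchOut; funToFin; finToFun)
open import Data.Fin.Properties
  using (suc-injective; toℕ-cast; toℕ-injective; combine-injective; pigeonhole; any?; finToFun-funToFin)
open import Data.Fin.Subset using (Subset; _∈_; ∣_∣; ⊥)
open import Data.Fin.Subset.Properties using (_∈?_; anySubset?; ⊆-antisym)
open import Data.Vec using (_∷_; here; there)
open import Data.Vec.Functional using (removeAt)
open import Data.Vec.Functional.Properties using (removeAt-punchOut)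
open import Data.Product using (∃; _×_; _,_; proj₁; proj₂)
open import Data.Sum using (_⊎_; inj₁; inj₂)
open import Data.Empty using (⊥-elim)
open import Data.List using (List; length; lookup)
open import Data.List.Relation.Unary.All using (All)
import Data.List.Relation.Unary.All as All
open import Data.List.Relation.Unary.AllPairs using (AllPairs; _∷_)
open import Data.List.Membership.Propositional.Properties using (∈-lookup)
open import Function using (_∘_)
open import Function.Bundles using (mk⇔; Equivalence)
open import Function.Definitions using (Injective)
import Axiom.UniquenessOfIdentityProofs as UIP
open import Relation.Nullary using (¬_; ¬?; Dec; yes; no; contradiction; _×-dec_)
open import Relation.Binary.PropositionalEquality

AllPairs-lookup : ∀ {A : Set} {R : A → A → Set} {xs : List A} → AllPairs R xs →
  ∀ {i j} → toℕ i < toℕ j → R (lookup xs i) (lookup xs j)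
AllPairs-lookup (px ∷ _)  {zero}  {suc j} _       = All.lookup px (∈-lookup j)
AllPairs-lookup (_ ∷ pxs) {suc i} {suc j} (s≤s i<j) = AllPairs-lookup pxs i<j

length≤-by-encoding : ∀ {A : Set} {P : A → Set} {R : A → A → Set} {N : ℕ}
  (code : ∀ {x} → P x → Fin N) →
  (∀ {x y} (px : P x) (py : P y) → code px ≡ code py → ¬ R x y) →
  ∀ {xs} → AllPairs R xs → All P xs → length xs ≤ N
length≤-by-encoding {N = N} code separates {xs} rs pxs with N <? length xs
... | no N≮len = ≮⇒≥ N≮len
... | yes N<len
  with i , j , i<j , same-code ← pigeonhole N<len (λ i → code (All.lookup pxs (∈-lookup i)))
  = ⊥-elim (separates _ _ same-code (AllPairs-lookup rs i<j))

rank : ∀ {n} {x : Fin n} {p : Subset n} → x ∈ p → Fin ∣ p ∣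
rank {p = true ∷ _}  here      = zero
rank {p = true ∷ _}  (there m) = suc (rank m)
rank {p = false ∷ _} (there m) = rank m

rank-injective : ∀ {n} {x y : Fin n} {p : Subset n} (x∈p : x ∈ p) (y∈p : y ∈ p) →
  rank x∈p ≡ rank y∈p → x ≡ y
rank-injective {p = true ∷ _}  here       here       _  = refl
rank-injective {p = true ∷ _}  (there x∈) (there y∈) eq =
  cong suc (rank-injective x∈ y∈ (suc-injective eq))
rank-injective {p = false ∷ _} (there x∈) (there y∈) eq = cong suc (rank-injective x∈ y∈ eq)

cast-rank-injective : ∀ {n r} {x y : Fin n} {p q : Subset n} → p ≡ q →
  (x∈p : x ∈ p) (y∈q : y ∈ q) .(e : ∣ p ∣ ≡ r) .(e′ : ∣ q ∣ ≡ r) →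
  cast e (rank x∈p) ≡ cast e′ (rank y∈q) → x ≡ y
cast-rank-injective refl x∈p y∈p e e′ eq = rank-injective x∈p y∈p (toℕ-injective (begin
  toℕ (rank x∈p)          ≡⟨ toℕ-cast e (rank x∈p) ⟨
  toℕ (cast e (rank x∈p)) ≡⟨ cong toℕ eq ⟩
  toℕ (cast e (rank y∈p)) ≡⟨ toℕ-cast e (rank y∈p) ⟩
  toℕ (rank y∈p)          ∎))
  where open ≡-Reasoning

encodeExcept : ∀ {k n} → Fin k → (Fin k → Fin n) → Fin (n ^ (k ∸ 1))
encodeExcept {suc _} l φ = funToFin (removeAt φ l)

encodeExcept-agrees : ∀ {k n} (l : Fin k) {φ ψ : Fin k → Fin n} →
  encodeExcept l φ ≡ encodeExcept l ψ → ∀ m → l ≢ m → φ m ≡ ψ m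
encodeExcept-agrees {suc _} l {φ} {ψ} eq m l≢m = begin
  φ m                                              ≡⟨ removeAt-punchOut φ l≢m ⟨
  removeAt φ l (punchOut l≢m)                      ≡⟨ finToFun-funToFin (removeAt φ l) _ ⟨
  finToFun (funToFin (removeAt φ l)) (punchOut l≢m) ≡⟨ cong (λ c → finToFun c (punchOut l≢m)) eq ⟩
  finToFun (funToFin (removeAt ψ l)) (punchOut l≢m) ≡⟨ finToFun-funToFin (removeAt ψ l) _ ⟩
  removeAt ψ l (punchOut l≢m)                      ≡⟨ removeAt-punchOut ψ l≢m ⟩
  ψ m                                              ∎
  where open ≡-Reasoning

Bool-≡-irrelevant : {a b : Bool} (p q : a ≡ b) → p ≡ q
Bool-≡-irrelevant = UIP.Decidable⇒UIP.≡-irrelevant Bool._≟_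

Bool-≡-from-⇔ : {a b : Bool} → (a ≡ true → b ≡ true) → (b ≡ true → a ≡ true) → a ≡ b
Bool-≡-from-⇔ {true}  to _    = sym (to refl)
Bool-≡-from-⇔ {false} {true}  _ from = from refl
Bool-≡-from-⇔ {false} {false} _ _    = refl

sameSubgraph-of-embedding : ∀ {k n} {F : Graph k} {G : Fin n → Fin n → Set} {c d : SubgraphData n}
  (c-copy : IsCopy F G c) (d-copy : IsCopy F G d) → proj₁ c-copy ≗ proj₁ d-copy → SameSubgraph c d
sameSubgraph-of-embedding {k} {n} {F} (φ , _ , _ , vert , edge) (ψ , _ , _ , vert′ , edge′) φ≗ψ =
  ⊆-antisym (λ {u} → from (vert′ u) ∘ image-transport φ≗ψ ∘ to (vert u))
            (λ {u} → from (vert u) ∘ image-transport ψ≗φ ∘ to (vert′ u)) ,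
  λ u v → Bool-≡-from-⇔ (from (edge′ u v) ∘ edge-image-transport φ≗ψ ∘ to (edge u v))
                        (from (edge u v) ∘ edge-image-transport ψ≗φ ∘ to (edge′ u v))
  where
    open Equivalence

    ψ≗φ : ψ ≗ φ
    ψ≗φ x = sym (φ≗ψ x)

    image-transport : {θ θ′ : Fin k → Fin n} → θ ≗ θ′ →
      ∀ {u} → ∃ (λ i → θ i ≡ u) → ∃ (λ i → θ′ i ≡ u)
    image-transport θ≗θ′ (i , θi≡u) = i , trans (sym (θ≗θ′ i)) θi≡u

    edge-image-transport : {θ θ′ : Fin k → Fin n} → θ ≗ θ′ → ∀ {u v} →
      ∃ (λ i → ∃ λ j → adj F i j ≡ true × θ i ≡ u × θ j ≡ v) →
      ∃ (λ i → ∃ λ j → adj F i j ≡ true × θ′ i ≡ u × θ′ j ≡ v)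
    edge-image-transport θ≗θ′ (i , j , a , θi≡u , θj≡v) =
      i , j , a , trans (sym (θ≗θ′ i)) θi≡u , trans (sym (θ≗θ′ j)) θj≡v

module ShadowCopies {r n} (H : Hypergraph r n) where

  HyperedgeThrough : Fin n → Fin n → Subset n → Set
  HyperedgeThrough u v e = IsEdge H e ≡ true × u ∈ e × v ∈ e

  hyperedgeThrough? : ∀ u v e → Dec (HyperedgeThrough u v e)
  hyperedgeThrough? u v e = (IsEdge H e Bool.≟ true) ×-dec (u ∈? e) ×-dec (v ∈? e)

  chosenHyperedge : Fin n → Fin n → Subset n
  chosenHyperedge u v with anySubset? (hyperedgeThrough? u v)
  ... | yes (e , _) = e
  ... | no _        = ⊥

  chosenHyperedge-through : ∀ {u v} → Shadow H u v → HyperedgeThrough u v (chosenHyperedge u v)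
  chosenHyperedge-through {u} {v} (_ , through)
    with anySubset? (hyperedgeThrough? u v)
  ... | yes (_ , e-through) = e-through
  ... | no  none            = contradiction through none

  ∣chosenHyperedge∣≡r : ∀ {u v} → Shadow H u v → ∣ chosenHyperedge u v ∣ ≡ r
  ∣chosenHyperedge∣≡r uv = uniform H _ (proj₁ (chosenHyperedge-through uv))

  module _ {k} (F : Graph k) where

    IsHom : (Fin k → Fin n) → Set
    IsHom φ = ∀ i j → adj F i j ≡ true → Shadow H (φ i) (φ j)

    StrayVertex : (Fin k → Fin n) → Set
    StrayVertex φ = ∃ λ i → ∃ λ j → ∃ λ l →
      adj F i j ≡ true × l ≢ i × l ≢ j × φ l ∈ chosenHyperedge (φ i) (φ j)

    strayVertex? : ∀ φ → Dec (StrayVertex φ)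
    strayVertex? φ = any? λ i → any? λ j → any? λ l →
      (adj F i j Bool.≟ true) ×-dec ¬? (l ≟ i) ×-dec ¬? (l ≟ j) ×-dec (φ l ∈? chosenHyperedge (φ i) (φ j))

    module _ {φ : Fin k → Fin n} (φ-injective : Injective _≡_ _≡_ φ) (φ-hom : IsHom φ)
             (no-stray : ¬ StrayVertex φ) where

      endpoints-only : ∀ {i j} → adj F i j ≡ true →
        ∀ l → φ l ∈ chosenHyperedge (φ i) (φ j) → l ≡ i ⊎ l ≡ j
      endpoints-only {i} {j} a l φl∈h with l ≟ i | l ≟ j
      ... | yes l≡i | _       = inj₁ l≡i
      ... | no  _   | yes l≡j = inj₂ l≡j
      ... | no  l≢i | no  l≢j = ⊥-elim (no-stray (i , j , l , a , l≢i , l≢j , φl∈h))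

      traceEdge : EdgeOf F → Subset n
      traceEdge (i , j , _) = chosenHyperedge (φ i) (φ j)

      traceEdge-injective : Injective _≡_ _≡_ traceEdge
      traceEdge-injective {i , j , i<j , a} {i′ , j′ , i′<j′ , a′} same
        with endpoints-only a i′ (subst (φ i′ ∈_) (sym same) (proj₁ (proj₂ through′)))
           | endpoints-only a j′ (subst (φ j′ ∈_) (sym same) (proj₂ (proj₂ through′)))
        where through′ = chosenHyperedge-through (φ-hom i′ j′ a′)
      ... | inj₁ refl | inj₁ refl = ⊥-elim (<-irrefl refl i′<j′)
      ... | inj₁ refl | inj₂ refl =
        cong₂ (λ lt e → i , j , lt , e) (<-irrelevant i<j i′<j′) (Bool-≡-irrelevant a a′)
      ... | inj₂ refl | inj₁ refl = ⊥-elim (<-asym i<j i′<j′)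
      ... | inj₂ refl | inj₂ refl = ⊥-elim (<-irrefl refl i′<j′)

      ¬stray⇒containsTr : ContainsTr F H
      ¬stray⇒containsTr =
        φ , φ-injective , traceEdge , traceEdge-injective ,
        (λ (_ , _ , _ , a) → proj₁ (through a)) ,
        λ (_ , _ , _ , a) l → mk⇔ (endpoints-only a l)
          (λ { (inj₁ refl) → proj₁ (proj₂ (through a)) ; (inj₂ refl) → proj₂ (proj₂ (through a)) })
        where
          through : ∀ {i j} (a : adj F i j ≡ true) → HyperedgeThrough (φ i) (φ j) (chosenHyperedge (φ i) (φ j))
          through a = chosenHyperedge-through (φ-hom _ _ a)

    strayVertex : ¬ ContainsTr F H → ∀ {φ} → Injective _≡_ _≡_ φ → IsHom φ → StrayVertex φ
    strayVertex tr-free {φ} φ-injective φ-hom with strayVertex? φ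
    ... | yes stray   = stray
    ... | no no-stray = contradiction (¬stray⇒containsTr φ-injective φ-hom no-stray) tr-free

    Code : Set
    Code = Fin (k * k * k * r * n ^ (k ∸ 1))

    code : ∀ {φ} → IsHom φ → StrayVertex φ → Code
    code {φ} φ-hom (i , j , l , a , _ , _ , φl∈h) =
      combine (combine (combine (combine i j) l) (cast (∣chosenHyperedge∣≡r (φ-hom i j a)) (rank φl∈h)))
              (encodeExcept l φ)

    code-injective : ∀ {φ ψ} (φ-hom : IsHom φ) (ψ-hom : IsHom ψ) s t →
      code φ-hom s ≡ code ψ-hom t → φ ≗ ψ
    code-injective {φ} {ψ} φ-hom ψ-hom (i , j , l , a , l≢i , l≢j , φl∈h) (i′ , j′ , l′ , a′ , _ , _ , ψl∈h′) same
      with ijl-rank≡ , rest≡ ← combine-injective _ _ _ _ same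
      with ijl≡ , rank≡ ← combine-injective _ _ _ _ ijl-rank≡
      with ij≡ , refl ← combine-injective (combine i j) l (combine i′ j′) l′ ijl≡
      with refl , refl ← combine-injective i j i′ j′ ij≡ = φ≗ψ
      where
        off-l : ∀ m → l ≢ m → φ m ≡ ψ m
        off-l = encodeExcept-agrees l rest≡

        at-l : φ l ≡ ψ l
        at-l = cast-rank-injective (cong₂ chosenHyperedge (off-l i l≢i) (off-l j l≢j)) φl∈h ψl∈h′
                 (∣chosenHyperedge∣≡r (φ-hom i j a)) (∣chosenHyperedge∣≡r (ψ-hom i j a′)) rank≡

        φ≗ψ : φ ≗ ψ
        φ≗ψ m with l ≟ m
        ... | yes refl = at-l
        ... | no  l≢m  = off-l m l≢m

    module _ (tr-free : ¬ ContainsTr F H) where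

      copyCode : ∀ {c} → IsCopy F (Shadow H) c → Code
      copyCode (_ , φ-injective , φ-hom , _) = code φ-hom (strayVertex tr-free φ-injective φ-hom)

      copyCode-injective : ∀ {c d} (c-copy : IsCopy F (Shadow H) c) (d-copy : IsCopy F (Shadow H) d) →
        copyCode c-copy ≡ copyCode d-copy → SameSubgraph c d
      copyCode-injective c-copy@(_ , φ-injective , φ-hom , _) d-copy@(_ , ψ-injective , ψ-hom , _) same =
        sameSubgraph-of-embedding {F = F} {G = Shadow H} c-copy d-copy
          (code-injective φ-hom ψ-hom (strayVertex tr-free φ-injective φ-hom)
                                      (strayVertex tr-free ψ-injective ψ-hom) same)

proposition4 : (r : ℕ) → 2 ≤ r → (k : ℕ) → (F : Graph k) →
    ∃ λ (C : ℕ) → (n : ℕ) → (H : Hypergraph r n) → ¬ ContainsTr F H →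
      (copies : List (SubgraphData n)) → AllPairs Distinct copies →
      All (IsCopy F (Shadow H)) copies →
      length copies ≤ C * n ^ (k ∸ 1)
-- The bound holds for every r.
proposition4 r _ k F = k * k * k * r , λ n H tr-free copies distinct are-copies →
  length≤-by-encoding (copyCode H F tr-free)
    (λ c-copy d-copy same-code c≠d → c≠d (copyCode-injective H F tr-free c-copy d-copy same-code))
    distinct are-copies
  where open ShadowCopies
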